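{- Let $m\ge1$ be an integer. Consider the $m$-row-restricted slicings, growing from the single cell. The children of a slicing are obtained by adding either a new horizontal block as a new topmost row, right-aligned with the bounding rectangle, or a new vertical block as a new rightmost column, top-aligned with the bounding rectangle, in all ways such that the result is an $m$-row-restricted slicing. Label each slicing by $(h,k)$, where $h$ is the maximal width of an addable horizontal block and $k$ is the height of the rightmost column. Then the root is labelled $(1,1)$, and the children of a slicing with label $(h,k)$ have labels given by the following rule $(\Upsilon_m)$: - $(1,k+1),(2,k+1),\ldots,(h,k+1)$; - together with $(h+1,1),(h+1,2),\ldots,(h+1,k)$ if $h<m$; - together with $(m,1),(m,2),\ldots,(m,k)$ if $h=m$.
   Context: Parallelogram polyominoes are edge-connected sets of unit cells bounded by two lattice paths with steps $(0,1)$ and $(1,0)$ meeting only at their endpoints. The size is $k+\ell-1$ for a $k\times\ell$ bounding rectangle. A Baxter slicing of size $n$ is such a polyomino of size $n$ divided into $n$ blocks, defined recursively: - for $n=1$, the single cell is the single block; - for $n\ge2$, one block is the topmost row (horizontal block) or the rightmost column (vertical block), and the other blocks form a Baxter slicing of the polyomino obtained by deleting it. An $m$-row-restricted slicing is a Baxter slicing all of whose horizontal blocks have width at most $m$. -}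

module Defs where

open import Data.Nat using (ℕ; zero; suc; _∸_; _≡ᵇ_; _<ᵇ_; _≤ᵇ_; _⊔_)
open import Data.Bool using (Bool; true; false; _∧_; if_then_else_)
open import Data.List using (List; []; _∷_; _++_; map; length; filterᵇ; foldr; upTo)
open import Data.Bool.ListAction using (any)
open import Data.Product using (_×_; _,_)

-- A finite set of cells
-- is described row by row: a Row is the list of x-coordinates of its
-- cells (left to right), and a Shape is the list of rows, TOP ROW FIRST;
-- the last element of the list is the row y = 0.

Row : Set
Row = List ℕ

Shape : Set
Shape = List Row

range : ℕ → ℕ → List ℕ
range a zero    = []
range a (suc n) = a ∷ range (suc a) n

consecutiveFrom : ℕ → List ℕ → Bool
consecutiveFrom x []       = true
consecutiveFrom x (y ∷ ys) = (y ≡ᵇ suc x) ∧ consecutiveFrom y ys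

isInterval : Row → Bool
isInterval []       = false
isInterval (x ∷ xs) = consecutiveFrom x xs

leftEnd : Row → ℕ
leftEnd []      = 0
leftEnd (x ∷ _) = x

rightEnd : Row → ℕ
rightEnd []           = 0
rightEnd (x ∷ [])     = suc x
rightEnd (_ ∷ y ∷ ys) = rightEnd (y ∷ ys)

width : Shape → ℕ
width = foldr (λ r w → rightEnd r ⊔ w) 0

-- Parallelogram polyomino (with bounding rectangle [0,width) × [0,height)):
-- every row is a nonempty segment, left ends and right ends weakly
-- increase going up, consecutive rows share a column (edge-connected and
-- the two boundary paths only meet at their endpoints), and the bottom
-- row starts at x = 0.
isPP : Shape → Bool
isPP []           = false
isPP (r ∷ [])     = isInterval r ∧ (leftEnd r ≡ᵇ 0)
isPP (u ∷ d ∷ rs) =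
  isInterval u ∧ (leftEnd d ≤ᵇ leftEnd u) ∧ (rightEnd d ≤ᵇ rightEnd u)
  ∧ (leftEnd u <ᵇ rightEnd d) ∧ isPP (d ∷ rs)

-- Slicings, as sequences of blocks added one at a time (the recursive
-- definition read backwards).

data Slicing : Set where
  cell : Slicing
  -- hor S a : new horizontal block = new topmost row with cells
  --           a , … , W-1 (right-aligned with the bounding rectangle of S,
  --           W = width of S)
  hor  : Slicing → ℕ → Slicing
  -- ver S j : new vertical block = new rightmost column x = W consisting
  --           of the cells of that column in the top j rows (top-aligned)
  ver  : Slicing → ℕ → Slicing

addCol : ℕ → ℕ → Shape → Shape
addCol W zero    rs       = rs
addCol W (suc j) []       = []
addCol W (suc j) (r ∷ rs) = (r ++ (W ∷ [])) ∷ addCol W j rs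

shape : Slicing → Shape
shape cell      = (0 ∷ []) ∷ []
shape (hor S a) = range a (width (shape S) ∸ a) ∷ shape S
shape (ver S j) = addCol (width (shape S)) j (shape S)

-- Baxter slicing: every intermediate shape is a parallelogram polyomino
-- (the removed block is then the whole topmost row / rightmost column,
-- and size = number of blocks).
isSlicing : Slicing → Bool
isSlicing cell      = true
isSlicing (hor S a) = isSlicing S ∧ isPP (shape (hor S a))
isSlicing (ver S j) =
  isSlicing S ∧ (1 ≤ᵇ j) ∧ (j ≤ᵇ length (shape S)) ∧ isPP (shape (ver S j))

-- all horizontal blocks have width at most m
-- (the initial cell has width 1 ≤ m in any case)
restricted : ℕ → Slicing → Bool
restricted m cell      = true
restricted m (hor S a) = ((width (shape S) ∸ a) ≤ᵇ m) ∧ restricted m S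
restricted m (ver S j) = restricted m S

valid : ℕ → Slicing → Bool
valid m S = isSlicing S ∧ restricted m S

-- candidate horizontal additions: left end a ∈ [0, W) (a ≥ W would give
-- an empty row)
horCands : Slicing → List Slicing
horCands S = map (hor S) (upTo (width (shape S)))

verCands : Slicing → List Slicing
verCands S = map (ver S) (range 1 (length (shape S)))

children : ℕ → Slicing → List Slicing
children m S = filterᵇ (valid m) (horCands S ++ verCands S)

maxAddableWidth : ℕ → Slicing → ℕ
maxAddableWidth m S =
  foldr _⊔_ 0 (map (λ a → width (shape S) ∸ a)
    (filterᵇ (λ a → valid m (hor S a)) (upTo (width (shape S)))))

rightColHeight : Slicing → ℕ
rightColHeight S =
  length (filterᵇ (any (λ x → x ≡ᵇ (width (shape S) ∸ 1))) (shape S))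

label : ℕ → Slicing → ℕ × ℕ
label m S = maxAddableWidth m S , rightColHeight S

rule : ℕ → ℕ × ℕ → List (ℕ × ℕ)
rule m (h , k) =
  map (λ i → (i , suc k)) (range 1 h)
  ++ (if h <ᵇ m then map (λ j → (suc h , j)) (range 1 k)
      else if h ≡ᵇ m then map (λ j → (m , j)) (range 1 k)
      else [])

-- A valid slicing S has a parallelogram polyomino as shape, so S is summarised by the
-- top row [l, W) of its shape and the number k of top rows ending at W, which is the
-- height of its rightmost column.  A new top row [a, W) is allowed exactly when
-- l ≤ a and W − a ≤ m, i.e. when its width is at most h = min(W − l, m); it has label
-- (W − a, k + 1).  A new column of height j is allowed exactly when j ≤ k; its top
-- row is [l, W + 1), so its label is (min(W + 1 − l, m), j) = (min(h + 1, m), j).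
-- For h ≤ m this is the rule Υ_m, up to the order of the children.

module Submission where

open import Defs
open import Data.Nat using (ℕ; zero; suc; _+_; _∸_; _⊔_; _⊓_; _≡ᵇ_; _<ᵇ_; _≤ᵇ_; _≤_; _<_; _≟_; _<?_; z≤n; s≤s; z<s)
open import Data.Nat.Properties
open import Data.Bool using (Bool; true; false; _∧_; if_then_else_; T)
open import Data.Bool.Properties using (∧-identityʳ; ∧-assoc; ∨-identityʳ)
open import Data.Bool.ListAction using (any)
open import Data.List using (List; []; _∷_; _++_; _∷ʳ_; map; length; filterᵇ; foldr; upTo; applyUpTo; reverse)
open import Data.List.Properties using (map-++; map-∘; ++-identityʳ; map-cong-local; filter-++; filter-all; filter-none; reverse-++; reverse-map)
open import Data.List.Relation.Unary.All as All using (All; []; _∷_)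
open import Data.List.Relation.Binary.Permutation.Propositional using (_↭_; ↭-reflexive; module PermutationReasoning)
open import Data.List.Relation.Binary.Permutation.Propositional.Properties using (↭-reverse; ++⁺)
open import Data.Product using (_×_; _,_; proj₁; proj₂)
open import Data.Empty using (⊥-elim)
open import Function using (_∘_; id; _⇔_; mk⇔; Equivalence)
open import Relation.Nullary using (¬_; yes; no)
open import Relation.Nullary.Decidable using (T?)
open import Relation.Nullary.Reflects using (of; det; fromEquivalence; _×-reflects_)
open import Relation.Binary.PropositionalEquality

∧≡true⇒ : ∀ {x y} → x ∧ y ≡ true → x ≡ true × y ≡ true
∧≡true⇒ {true} e = refl , e

≡true⇒T : ∀ {b} → b ≡ true → T b
≡true⇒T refl = _

T⇒≡true : ∀ {b} → T b → b ≡ true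
T⇒≡true {true} _ = refl

≤ᵇ≡true⇒≤ : ∀ {m n} → (m ≤ᵇ n) ≡ true → m ≤ n
≤ᵇ≡true⇒≤ {m} {n} e = ≤ᵇ⇒≤ m n (≡true⇒T e)

≤⇒≤ᵇ≡true : ∀ {m n} → m ≤ n → (m ≤ᵇ n) ≡ true
≤⇒≤ᵇ≡true = T⇒≡true ∘ ≤⇒≤ᵇ

≰⇒≤ᵇ≡false : ∀ {m n} → ¬ m ≤ n → (m ≤ᵇ n) ≡ false
≰⇒≤ᵇ≡false {m} {n} m≰n = det (≤ᵇ-reflects-≤ m n) (of m≰n)

≮⇒<ᵇ≡false : ∀ {m n} → ¬ m < n → (m <ᵇ n) ≡ false
≮⇒<ᵇ≡false {m} {n} m≮n = det (<ᵇ-reflects-< m n) (of m≮n)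

≡ᵇ≡true⇒≡ : ∀ m n → (m ≡ᵇ n) ≡ true → m ≡ n
≡ᵇ≡true⇒≡ m n e = ≡ᵇ⇒≡ m n (≡true⇒T e)

≢⇒≡ᵇ≡false : ∀ {m n} → m ≢ n → (m ≡ᵇ n) ≡ false
≢⇒≡ᵇ≡false {m} {n} m≢n = det (fromEquivalence (≡ᵇ⇒≡ m n) (≡⇒≡ᵇ m n)) (of m≢n)

≡ᵇ-refl : ∀ n → (n ≡ᵇ n) ≡ true
≡ᵇ-refl n = T⇒≡true (≡⇒≡ᵇ n n refl)

filterᵇ-all : ∀ {A : Set} (p : A → Bool) {xs} → All (λ x → p x ≡ true) xs → filterᵇ p xs ≡ xs
filterᵇ-all p = filter-all (T? ∘ p) ∘ All.map ≡true⇒T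

filterᵇ-none : ∀ {A : Set} (p : A → Bool) {xs} → All (λ x → p x ≡ false) xs → filterᵇ p xs ≡ []
filterᵇ-none p = filter-none (T? ∘ p) ∘ All.map (λ px≡false → subst T px≡false)

filterᵇ-map : ∀ {A B : Set} (p : B → Bool) (f : A → B) xs →
  filterᵇ p (map f xs) ≡ map f (filterᵇ (p ∘ f) xs)
filterᵇ-map p f [] = refl
filterᵇ-map p f (x ∷ xs) with p (f x)
... | true  = cong (f x ∷_) (filterᵇ-map p f xs)
... | false = filterᵇ-map p f xs

∸≤⊓⇔ : ∀ {W l} a m → l ≤ W → W ∸ a ≤ (W ∸ l) ⊓ m ⇔ (l ≤ a × W ∸ a ≤ m)
∸≤⊓⇔ {W} {l} a m l≤W = mk⇔
  (λ le → ∸-cancelʳ-≤ l≤W (≤-trans le (m⊓n≤m _ m)) , ≤-trans le (m⊓n≤n _ m))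
  (λ (l≤a , W∸a≤m) → ⊓-glb (∸-monoʳ-≤ W l≤a) W∸a≤m)

≤ᵇ∧∸≤ᵇ≡∸≤ᵇ⊓ : ∀ {W l} a m → l ≤ W → ((l ≤ᵇ a) ∧ (W ∸ a ≤ᵇ m)) ≡ (W ∸ a ≤ᵇ (W ∸ l) ⊓ m)
≤ᵇ∧∸≤ᵇ≡∸≤ᵇ⊓ {W} {l} a m l≤W =
  det (≤ᵇ-reflects-≤ l a ×-reflects ≤ᵇ-reflects-≤ (W ∸ a) m)
      (fromEquivalence (Equivalence.to equiv ∘ ≤ᵇ⇒≤ _ _) (≤⇒≤ᵇ ∘ Equivalence.from equiv))
  where
  equiv : W ∸ a ≤ (W ∸ l) ⊓ m ⇔ (l ≤ a × W ∸ a ≤ m)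
  equiv = ∸≤⊓⇔ a m l≤W

suc-⊓-absorb : ∀ x m → suc (x ⊓ m) ⊓ m ≡ suc x ⊓ m
suc-⊓-absorb x m = begin
  suc (x ⊓ m) ⊓ m     ≡⟨⟩
  (suc x ⊓ suc m) ⊓ m ≡⟨ ⊓-assoc (suc x) (suc m) m ⟩
  suc x ⊓ (suc m ⊓ m) ≡⟨ cong (suc x ⊓_) (m≥n⇒m⊓n≡n (n≤1+n m)) ⟩
  suc x ⊓ m           ∎
  where open ≡-Reasoning

range-++ : ∀ a r s → range a (r + s) ≡ range a r ++ range (a + r) s
range-++ a zero    s = cong (λ b → range b s) (sym (+-identityʳ a))
range-++ a (suc r) s =
  cong (a ∷_) (trans (range-++ (suc a) r s) (cong (λ b → range (suc a) r ++ range b s) (sym (+-suc a r))))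

range-suc : ∀ a n → range a (suc n) ≡ range a n ∷ʳ (a + n)
range-suc a n = trans (cong (range a) (+-comm 1 n)) (range-++ a n 1)

upTo≡range : ∀ n → upTo n ≡ range 0 n
upTo≡range n = go id 0 n (λ _ → refl)
  where
  go : ∀ (f : ℕ → ℕ) a n → (∀ x → f x ≡ a + x) → applyUpTo f n ≡ range a n
  go f a zero    f≗ = refl
  go f a (suc n) f≗ =
    cong₂ _∷_ (trans (f≗ 0) (+-identityʳ a)) (go (f ∘ suc) (suc a) n (λ x → trans (f≗ (suc x)) (+-suc a x)))

All-range : ∀ {P : ℕ → Set} a n → (∀ x → a ≤ x → x < a + n → P x) → All P (range a n)
All-range a zero    P-in = []
All-range a (suc n) P-in =
  P-in a ≤-refl (m<m+n a z<s) ∷ All-range (suc a) n (λ x a<x x<a+1+n → P-in x (<⇒≤ a<x) (subst (x <_) (sym (+-suc a n)) x<a+1+n))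

filterᵇ-range-suffix : ∀ (p : ℕ → Bool) a r s →
  All (λ x → p x ≡ false) (range a r) → All (λ x → p x ≡ true) (range (a + r) s) →
  filterᵇ p (range a (r + s)) ≡ range (a + r) s
filterᵇ-range-suffix p a r s rejected accepted = begin
  filterᵇ p (range a (r + s))                        ≡⟨ cong (filterᵇ p) (range-++ a r s) ⟩
  filterᵇ p (range a r ++ range (a + r) s)           ≡⟨ filter-++ (T? ∘ p) (range a r) _ ⟩
  filterᵇ p (range a r) ++ filterᵇ p (range (a + r) s) ≡⟨ cong₂ _++_ (filterᵇ-none p rejected) (filterᵇ-all p accepted) ⟩
  range (a + r) s                                    ∎
  where open ≡-Reasoning

filterᵇ-range-prefix : ∀ (p : ℕ → Bool) a r s →
  All (λ x → p x ≡ true) (range a r) → All (λ x → p x ≡ false) (range (a + r) s) →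
  filterᵇ p (range a (r + s)) ≡ range a r
filterᵇ-range-prefix p a r s accepted rejected = begin
  filterᵇ p (range a (r + s))                        ≡⟨ cong (filterᵇ p) (range-++ a r s) ⟩
  filterᵇ p (range a r ++ range (a + r) s)           ≡⟨ filter-++ (T? ∘ p) (range a r) _ ⟩
  filterᵇ p (range a r) ++ filterᵇ p (range (a + r) s) ≡⟨ cong₂ _++_ (filterᵇ-all p accepted) (filterᵇ-none p rejected) ⟩
  range a r ++ []                                    ≡⟨ ++-identityʳ (range a r) ⟩
  range a r                                          ∎
  where open ≡-Reasoning

reverse-range-suc : ∀ n → reverse (range 1 (suc n)) ≡ suc n ∷ reverse (range 1 n)
reverse-range-suc n = trans (cong reverse (range-suc 1 n)) (reverse-++ (range 1 n) (suc n ∷ []))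

map-∸-range : ∀ W s n → s + n ≡ W → map (W ∸_) (range s n) ≡ reverse (range 1 n)
map-∸-range W s zero    _  = refl
map-∸-range W s (suc n) eq = begin
  W ∸ s ∷ map (W ∸_) (range (suc s) n) ≡⟨ cong₂ _∷_ W∸s≡1+n (map-∸-range W (suc s) n (trans (sym (+-suc s n)) eq)) ⟩
  suc n ∷ reverse (range 1 n)          ≡⟨ sym (reverse-range-suc n) ⟩
  reverse (range 1 (suc n))            ∎
  where
  open ≡-Reasoning
  W∸s≡1+n : W ∸ s ≡ suc n
  W∸s≡1+n = trans (cong (_∸ s) (sym eq)) (m+n∸m≡n s (suc n))

max-reverse-range : ∀ n → foldr _⊔_ 0 (reverse (range 1 n)) ≡ n
max-reverse-range zero    = refl
max-reverse-range (suc n) rewrite reverse-range-suc n | max-reverse-range n = m≥n⇒m⊔n≡m (n≤1+n n)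

consecutiveFrom-range : ∀ a n → consecutiveFrom a (range (suc a) n) ≡ true
consecutiveFrom-range a zero    = refl
consecutiveFrom-range a (suc n) rewrite ≡ᵇ-refl a = consecutiveFrom-range (suc a) n

rightEnd-range : ∀ a n → rightEnd (range a (suc n)) ≡ suc n + a
rightEnd-range a zero    = refl
rightEnd-range a (suc n) = trans (rightEnd-range (suc a) n) (cong suc (+-suc n a))

range-∸-ends : ∀ a W → a < W → rightEnd (range a (W ∸ a)) ≡ W × leftEnd (range a (W ∸ a)) ≡ a
range-∸-ends a W a<W with W ∸ a in W∸a
... | zero  = ⊥-elim (<⇒≱ (m<n⇒0<n∸m a<W) (≤-reflexive W∸a))
... | suc n = trans (rightEnd-range a n) (sym (trans (sym (m∸n+n≡m (<⇒≤ a<W))) (cong (_+ a) W∸a))) , refl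

consecutiveFrom-∷ʳ : ∀ x xs W → consecutiveFrom x (xs ∷ʳ W) ≡ consecutiveFrom x xs ∧ (W ≡ᵇ rightEnd (x ∷ xs))
consecutiveFrom-∷ʳ x []       W = ∧-identityʳ _
consecutiveFrom-∷ʳ x (y ∷ ys) W rewrite consecutiveFrom-∷ʳ y ys W = sym (∧-assoc (y ≡ᵇ suc x) _ _)

rightEnd-∷ʳ : ∀ r W → rightEnd (r ∷ʳ W) ≡ suc W
rightEnd-∷ʳ []           W = refl
rightEnd-∷ʳ (x ∷ [])     W = refl
rightEnd-∷ʳ (x ∷ y ∷ ys) W = rightEnd-∷ʳ (y ∷ ys) W

consecutiveFrom⇒< : ∀ x xs → consecutiveFrom x xs ≡ true → x < rightEnd (x ∷ xs)
consecutiveFrom⇒< x []       _ = ≤-refl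
consecutiveFrom⇒< x (y ∷ ys) e with ∧≡true⇒ {y ≡ᵇ suc x} e
... | y≡ᵇ1+x , e′ with ≡ᵇ≡true⇒≡ y (suc x) y≡ᵇ1+x
... | refl = <-trans (n<1+n x) (consecutiveFrom⇒< y ys e′)

any-≡ᵇ-segment : ∀ x xs c → consecutiveFrom x xs ≡ true → rightEnd (x ∷ xs) ≤ suc c →
  any (λ y → y ≡ᵇ c) (x ∷ xs) ≡ (rightEnd (x ∷ xs) ≡ᵇ suc c)
any-≡ᵇ-segment x []       c _ _ = ∨-identityʳ _
any-≡ᵇ-segment x (y ∷ ys) c e end≤ with ∧≡true⇒ {y ≡ᵇ suc x} e
... | y≡ᵇ1+x , e′ with ≡ᵇ≡true⇒≡ y (suc x) y≡ᵇ1+x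
... | refl with x ≡ᵇ c in x≡ᵇc
... | true  = ⊥-elim (<⇒≱ (≤-trans (consecutiveFrom⇒< y ys e′) end≤)
                          (s≤s (≤-reflexive (sym (≡ᵇ≡true⇒≡ x c x≡ᵇc)))))
... | false = any-≡ᵇ-segment y ys c e′ end≤

topRow : Shape → Row
topRow []      = []
topRow (r ∷ _) = r

isPP-∷⁻ : ∀ u d rs → isPP (u ∷ d ∷ rs) ≡ true →
  isInterval u ≡ true × (leftEnd d ≤ᵇ leftEnd u) ≡ true × (rightEnd d ≤ᵇ rightEnd u) ≡ true
  × (leftEnd u <ᵇ rightEnd d) ≡ true × isPP (d ∷ rs) ≡ true
isPP-∷⁻ u d rs e with ∧≡true⇒ {isInterval u} e
... | e₁ , e₂ with ∧≡true⇒ {leftEnd d ≤ᵇ leftEnd u} e₂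
... | e₃ , e₄ with ∧≡true⇒ {rightEnd d ≤ᵇ rightEnd u} e₄
... | e₅ , e₆ with ∧≡true⇒ {leftEnd u <ᵇ rightEnd d} e₆
... | e₇ , e₈ = e₁ , e₃ , e₅ , e₇ , e₈

isPP-tail : ∀ u d rs → isPP (u ∷ d ∷ rs) ≡ true → isPP (d ∷ rs) ≡ true
isPP-tail u d rs = proj₂ ∘ proj₂ ∘ proj₂ ∘ proj₂ ∘ isPP-∷⁻ u d rs

isPP-rightEnd-≤ : ∀ u d rs → isPP (u ∷ d ∷ rs) ≡ true → rightEnd d ≤ rightEnd u
isPP-rightEnd-≤ u d rs = ≤ᵇ≡true⇒≤ ∘ proj₁ ∘ proj₂ ∘ proj₂ ∘ isPP-∷⁻ u d rs

isPP-top-isInterval : ∀ u rs → isPP (u ∷ rs) ≡ true → isInterval u ≡ true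
isPP-top-isInterval u []       = proj₁ ∘ ∧≡true⇒ {isInterval u}
isPP-top-isInterval u (d ∷ rs) = proj₁ ∘ ∧≡true⇒ {isInterval u}

isPP⇒width≡ : ∀ rs → isPP rs ≡ true → width rs ≡ rightEnd (topRow rs)
isPP⇒width≡ (r ∷ [])     _ = ⊔-identityʳ _
isPP⇒width≡ (u ∷ d ∷ rs) e rewrite isPP⇒width≡ (d ∷ rs) (isPP-tail u d rs e) = m≥n⇒m⊔n≡m (isPP-rightEnd-≤ u d rs e)

isPP⇒top-< : ∀ rs → isPP rs ≡ true → leftEnd (topRow rs) < rightEnd (topRow rs)
isPP⇒top-< ([] ∷ rs)       e with () ← isPP-top-isInterval [] rs e
isPP⇒top-< ((x ∷ xs) ∷ rs) e = consecutiveFrom⇒< x xs (isPP-top-isInterval (x ∷ xs) rs e)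

-- In a parallelogram polyomino of width W the rows meeting column W − 1 are the
-- leading rows ending at W.
leadingRowsEndingAt : ℕ → Shape → ℕ
leadingRowsEndingAt W []       = 0
leadingRowsEndingAt W (r ∷ rs) = if W ≡ᵇ rightEnd r then suc (leadingRowsEndingAt W rs) else 0

leadingRowsEndingAt≤length : ∀ W rs → leadingRowsEndingAt W rs ≤ length rs
leadingRowsEndingAt≤length W []       = z≤n
leadingRowsEndingAt≤length W (r ∷ rs) with W ≡ᵇ rightEnd r
... | true  = s≤s (leadingRowsEndingAt≤length W rs)
... | false = z≤n

rowsContaining-≡[] : ∀ c rs → isPP rs ≡ true → rightEnd (topRow rs) ≤ c → filterᵇ (any (λ y → y ≡ᵇ c)) rs ≡ []
rowsContaining-≡[] c ([] ∷ rs) e _ with () ← isPP-top-isInterval [] rs e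
rowsContaining-≡[] c ((x ∷ xs) ∷ rs) e end≤c
  rewrite any-≡ᵇ-segment x xs c (isPP-top-isInterval (x ∷ xs) rs e) (m≤n⇒m≤1+n end≤c)
        | ≢⇒≡ᵇ≡false (<⇒≢ (s≤s end≤c)) with rs
... | []     = refl
... | d ∷ ds = rowsContaining-≡[] c (d ∷ ds) (isPP-tail (x ∷ xs) d ds e) (≤-trans (isPP-rightEnd-≤ (x ∷ xs) d ds e) end≤c)

rowsContaining-length : ∀ c rs → isPP rs ≡ true → rightEnd (topRow rs) ≤ suc c →
  length (filterᵇ (any (λ y → y ≡ᵇ c)) rs) ≡ leadingRowsEndingAt (suc c) rs
rowsContaining-length c ([] ∷ rs) e _ with () ← isPP-top-isInterval [] rs e
rowsContaining-length c ((x ∷ xs) ∷ rs) e end≤ with rightEnd (x ∷ xs) ≟ suc c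
... | no end≢ rewrite ≢⇒≡ᵇ≡false (end≢ ∘ sym) =
  cong length (rowsContaining-≡[] c ((x ∷ xs) ∷ rs) e (≤-pred (≤∧≢⇒< end≤ end≢)))
... | yes end≡
  rewrite any-≡ᵇ-segment x xs c (isPP-top-isInterval (x ∷ xs) rs e) end≤
        | end≡ | ≡ᵇ-refl c with rs
...   | []     = refl
...   | d ∷ ds = cong suc (rowsContaining-length c (d ∷ ds) (isPP-tail (x ∷ xs) d ds e)
                                                  (subst (rightEnd d ≤_) end≡ (isPP-rightEnd-≤ (x ∷ xs) d ds e)))

rightColumn-height : ∀ rs → isPP rs ≡ true →
  length (filterᵇ (any (λ y → y ≡ᵇ (rightEnd (topRow rs) ∸ 1))) rs) ≡ leadingRowsEndingAt (rightEnd (topRow rs)) rs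
rightColumn-height rs e with rightEnd (topRow rs) in end | isPP⇒top-< rs e
... | suc c | _ = rowsContaining-length c rs e (≤-reflexive end)

isPP-newRow : ∀ rs a → isPP rs ≡ true → a < rightEnd (topRow rs) →
  isPP (range a (rightEnd (topRow rs) ∸ a) ∷ rs) ≡ (leftEnd (topRow rs) ≤ᵇ a)
isPP-newRow ([] ∷ rs)         a e _ with () ← isPP-top-isInterval [] rs e
isPP-newRow ((x ∷ xs) ∷ rs) a e a<end with rightEnd (x ∷ xs) ∸ a in end∸a
... | zero  = ⊥-elim (<⇒≱ (m<n⇒0<n∸m a<end) (≤-reflexive end∸a))
... | suc n
  rewrite consecutiveFrom-range a n | rightEnd-range a n
        | ≤⇒≤ᵇ≡true {rightEnd (x ∷ xs)} {suc n + a} (≤-reflexive (trans (sym (m∸n+n≡m (<⇒≤ a<end))) (cong (_+ a) end∸a)))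
        | T⇒≡true (<⇒<ᵇ a<end) | e = ∧-identityʳ _

isPP-addCol : ∀ W j rs → isPP rs ≡ true → rightEnd (topRow rs) ≤ W → suc j ≤ length rs →
  isPP (addCol W (suc j) rs) ≡ (suc j ≤ᵇ leadingRowsEndingAt W rs)
isPP-addCol W j ([] ∷ rs) e _ _ with () ← isPP-top-isInterval [] rs e
isPP-addCol W zero ((x ∷ xs) ∷ []) e _ _ with ∧≡true⇒ {consecutiveFrom x xs} e
... | e₁ , e₂ rewrite consecutiveFrom-∷ʳ x xs W | e₁ | e₂ with W ≡ᵇ rightEnd (x ∷ xs)
... | true  = refl
... | false = refl
isPP-addCol W zero ((x ∷ xs) ∷ d ∷ rs) e end≤W _ with isPP-∷⁻ (x ∷ xs) d rs e
... | e₁ , e₂ , e₃ , e₄ , e₅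
  rewrite consecutiveFrom-∷ʳ x xs W | e₁ | e₂ | e₄ | e₅ | rightEnd-∷ʳ (x ∷ xs) W
        | ≤⇒≤ᵇ≡true {rightEnd d} {suc W} (≤-trans (≤ᵇ≡true⇒≤ e₃) (m≤n⇒m≤1+n end≤W))
  with W ≡ᵇ rightEnd (x ∷ xs)
... | true  = refl
... | false = refl
isPP-addCol W (suc j) ((x ∷ xs) ∷ []) _ _ (s≤s ())
isPP-addCol W (suc j) ((x ∷ xs) ∷ [] ∷ rs) e _ _ with () ← isPP-top-isInterval [] rs (isPP-tail (x ∷ xs) [] rs e)
isPP-addCol W (suc j) ((x ∷ xs) ∷ (y ∷ ys) ∷ rs) e end≤W (s≤s j<len) with isPP-∷⁻ (x ∷ xs) (y ∷ ys) rs e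
... | e₁ , e₂ , e₃ , e₄ , e₅
  rewrite consecutiveFrom-∷ʳ x xs W | e₁ | e₂ | rightEnd-∷ʳ (x ∷ xs) W | rightEnd-∷ʳ (y ∷ ys) W
        | ≤⇒≤ᵇ≡true (≤-refl {suc W})
        | T⇒≡true (<⇒<ᵇ (≤-trans (consecutiveFrom⇒< x xs e₁) (m≤n⇒m≤1+n end≤W)))
        | isPP-addCol W j ((y ∷ ys) ∷ rs) e₅ (≤-trans (≤ᵇ≡true⇒≤ e₃) end≤W) j<len
  with W ≡ᵇ rightEnd (x ∷ xs)
... | true  = refl
... | false = refl

topRow-addCol : ∀ W j rs → isPP rs ≡ true →
  rightEnd (topRow (addCol W (suc j) rs)) ≡ suc W × leftEnd (topRow (addCol W (suc j) rs)) ≡ leftEnd (topRow rs)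
topRow-addCol W j ([] ∷ rs)       e with () ← isPP-top-isInterval [] rs e
topRow-addCol W j ((x ∷ xs) ∷ rs) _ = rightEnd-∷ʳ (x ∷ xs) W , refl

leadingRowsEndingAt-addCol : ∀ W j rs → isPP rs ≡ true → rightEnd (topRow rs) ≤ W → j ≤ length rs →
  leadingRowsEndingAt (suc W) (addCol W j rs) ≡ j
leadingRowsEndingAt-addCol W zero    []       _ _ _ = refl
leadingRowsEndingAt-addCol W zero    (u ∷ rs) _ end≤W _ rewrite ≢⇒≡ᵇ≡false (<⇒≢ (s≤s end≤W) ∘ sym) = refl
leadingRowsEndingAt-addCol W (suc j) (u ∷ []) _ _ (s≤s z≤n) rewrite rightEnd-∷ʳ u W | ≡ᵇ-refl W = refl
leadingRowsEndingAt-addCol W (suc j) (u ∷ d ∷ rs) e end≤W (s≤s j≤len) rewrite rightEnd-∷ʳ u W | ≡ᵇ-refl W =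
  cong suc (leadingRowsEndingAt-addCol W j (d ∷ rs) (isPP-tail u d rs e) (≤-trans (isPP-rightEnd-≤ u d rs e) end≤W) j≤len)

isSlicing⇒isPP : ∀ S → isSlicing S ≡ true → isPP (shape S) ≡ true
isSlicing⇒isPP cell      _ = refl
isSlicing⇒isPP (hor S a) e = proj₂ (∧≡true⇒ {isSlicing S} e)
isSlicing⇒isPP (ver S j) e with ∧≡true⇒ {isSlicing S} e
... | _ , e′ with ∧≡true⇒ {1 ≤ᵇ j} e′
... | _ , e″ = proj₂ (∧≡true⇒ {j ≤ᵇ length (shape S)} e″)

topLeft topRight : Slicing → ℕ
topLeft  S = leftEnd (topRow (shape S))
topRight S = rightEnd (topRow (shape S))

-- The label (h, k) of the paper is (maxNewRow m S , rightColumn S).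
maxNewRow : ℕ → Slicing → ℕ
maxNewRow m S = (topRight S ∸ topLeft S) ⊓ m

rightColumn : Slicing → ℕ
rightColumn S = leadingRowsEndingAt (topRight S) (shape S)

maxNewRow≤topRight : ∀ m S → maxNewRow m S ≤ topRight S
maxNewRow≤topRight m S = ≤-trans (m⊓n≤m _ m) (m∸n≤m (topRight S) (topLeft S))

module ValidSlicing (m : ℕ) (S : Slicing) (valid-S : valid m S ≡ true) where

  W h k : ℕ
  W = topRight S
  h = maxNewRow m S
  k = rightColumn S

  slicing-S : isSlicing S ≡ true
  slicing-S = proj₁ (∧≡true⇒ {isSlicing S} valid-S)
  restricted-S : restricted m S ≡ true
  restricted-S = proj₂ (∧≡true⇒ {isSlicing S} valid-S)
  isPP-S : isPP (shape S) ≡ true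
  isPP-S = isSlicing⇒isPP S slicing-S
  width≡W : width (shape S) ≡ W
  width≡W = isPP⇒width≡ (shape S) isPP-S
  left<W : topLeft S < W
  left<W = isPP⇒top-< (shape S) isPP-S
  h≤W : h ≤ W
  h≤W = maxNewRow≤topRight m S


  W∸h≤a⇒W∸a≤h : ∀ {a} → W ∸ h ≤ a → W ∸ a ≤ h
  W∸h≤a⇒W∸a≤h {a} W∸h≤a = subst (W ∸ a ≤_) (m∸[m∸n]≡n h≤W) (∸-monoʳ-≤ W W∸h≤a)

  valid-hor : ∀ a → a < W → valid m (hor S a) ≡ (W ∸ a ≤ᵇ h)
  valid-hor a a<W
    rewrite slicing-S | restricted-S | width≡W | isPP-newRow (shape S) a isPP-S a<W
          | ∧-identityʳ (W ∸ a ≤ᵇ m) = ≤ᵇ∧∸≤ᵇ≡∸≤ᵇ⊓ a m (<⇒≤ left<W)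

  valid-ver : ∀ j → suc j ≤ length (shape S) → valid m (ver S (suc j)) ≡ (suc j ≤ᵇ k)
  valid-ver j j<len
    rewrite slicing-S | restricted-S | ≤⇒≤ᵇ≡true j<len | width≡W
          | isPP-addCol W j (shape S) isPP-S ≤-refl j<len = ∧-identityʳ _

  hor-validLefts : filterᵇ (λ a → valid m (hor S a)) (upTo (width (shape S))) ≡ range (W ∸ h) h
  hor-validLefts = begin
    filterᵇ p (upTo (width (shape S))) ≡⟨ cong (λ w → filterᵇ p (upTo w)) width≡W ⟩
    filterᵇ p (upTo W)                 ≡⟨ cong (filterᵇ p) (trans (upTo≡range W) (cong (range 0) (sym (m∸n+n≡m h≤W)))) ⟩
    filterᵇ p (range 0 (W ∸ h + h))
      ≡⟨ filterᵇ-range-suffix p 0 (W ∸ h) h (All-range 0 (W ∸ h) rejected) (All-range (W ∸ h) h accepted) ⟩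
    range (W ∸ h) h                    ∎
    where
    open ≡-Reasoning
    p : ℕ → Bool
    p a = valid m (hor S a)
    rejected : ∀ x → 0 ≤ x → x < W ∸ h → p x ≡ false
    rejected x _ x<W∸h = trans (valid-hor x (<-≤-trans x<W∸h (m∸n≤m W h))) (≰⇒≤ᵇ≡false λ W∸x≤h →
      <⇒≱ x<W∸h (∸-cancelʳ-≤ (m∸n≤m W h) (subst (W ∸ x ≤_) (sym (m∸[m∸n]≡n h≤W)) W∸x≤h)))
    accepted : ∀ x → W ∸ h ≤ x → x < W ∸ h + h → p x ≡ true
    accepted x W∸h≤x x<W = trans (valid-hor x (subst (x <_) (m∸n+n≡m h≤W) x<W)) (≤⇒≤ᵇ≡true (W∸h≤a⇒W∸a≤h W∸h≤x))

  ver-validHeights : filterᵇ (λ j → valid m (ver S j)) (range 1 (length (shape S))) ≡ range 1 k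
  ver-validHeights = begin
    filterᵇ p (range 1 H)           ≡⟨ cong (filterᵇ p ∘ range 1) (sym (m+[n∸m]≡n k≤H)) ⟩
    filterᵇ p (range 1 (k + (H ∸ k)))
      ≡⟨ filterᵇ-range-prefix p 1 k (H ∸ k) (All-range 1 k accepted) (All-range (suc k) (H ∸ k) rejected) ⟩
    range 1 k                        ∎
    where
    open ≡-Reasoning
    H : ℕ
    H = length (shape S)
    k≤H : k ≤ H
    k≤H = leadingRowsEndingAt≤length W (shape S)
    p : ℕ → Bool
    p j = valid m (ver S j)
    accepted : ∀ x → 1 ≤ x → x < suc k → p x ≡ true
    accepted (suc j) _ j<k = trans (valid-ver j (≤-trans (≤-pred j<k) k≤H)) (≤⇒≤ᵇ≡true (≤-pred j<k))
    rejected : ∀ x → suc k ≤ x → x < suc k + (H ∸ k) → p x ≡ false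
    rejected (suc j) k<1+j j<H = trans (valid-ver j (subst (suc j ≤_) (m+[n∸m]≡n k≤H) (≤-pred j<H)))
      (≰⇒≤ᵇ≡false (<⇒≱ k<1+j))

  children-≡ : children m S ≡ map (hor S) (range (W ∸ h) h) ++ map (ver S) (range 1 k)
  children-≡ = begin
    filterᵇ (valid m) (horCands S ++ verCands S)                     ≡⟨ filter-++ (T? ∘ valid m) (horCands S) (verCands S) ⟩
    filterᵇ (valid m) (horCands S) ++ filterᵇ (valid m) (verCands S) ≡⟨ cong₂ _++_ hors vers ⟩
    map (hor S) (range (W ∸ h) h) ++ map (ver S) (range 1 k)         ∎
    where
    open ≡-Reasoning
    hors : filterᵇ (valid m) (horCands S) ≡ map (hor S) (range (W ∸ h) h)
    hors = trans (filterᵇ-map (valid m) (hor S) (upTo (width (shape S)))) (cong (map (hor S)) hor-validLefts)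
    vers : filterᵇ (valid m) (verCands S) ≡ map (ver S) (range 1 k)
    vers = trans (filterᵇ-map (valid m) (ver S) (range 1 (length (shape S)))) (cong (map (ver S)) ver-validHeights)

  label-≡ : label m S ≡ (h , k)
  label-≡ = cong₂ _,_ maxAddableWidth≡ rightColHeight≡
    where
    open ≡-Reasoning
    maxAddableWidth≡ : maxAddableWidth m S ≡ h
    maxAddableWidth≡ = begin
      maxAddableWidth m S                                         ≡⟨ cong (foldr _⊔_ 0 ∘ map (width (shape S) ∸_)) hor-validLefts ⟩
      foldr _⊔_ 0 (map (width (shape S) ∸_) (range (W ∸ h) h))    ≡⟨ cong (λ w → foldr _⊔_ 0 (map (w ∸_) (range (W ∸ h) h))) width≡W ⟩
      foldr _⊔_ 0 (map (W ∸_) (range (W ∸ h) h))                  ≡⟨ cong (foldr _⊔_ 0) (map-∸-range W (W ∸ h) h (m∸n+n≡m h≤W)) ⟩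
      foldr _⊔_ 0 (reverse (range 1 h))                           ≡⟨ max-reverse-range h ⟩
      h                                                           ∎
    rightColHeight≡ : rightColHeight S ≡ k
    rightColHeight≡ rewrite width≡W = rightColumn-height (shape S) isPP-S

rule-≡ : ∀ m h k → h ≤ m →
  rule m (h , k) ≡ map (_, suc k) (range 1 h) ++ map (suc h ⊓ m ,_) (range 1 k)
rule-≡ m h k h≤m with h <? m
... | yes h<m rewrite T⇒≡true (<⇒<ᵇ h<m) | m≤n⇒m⊓n≡m h<m = refl
... | no h≮m with ≤-antisym h≤m (≮⇒≥ h≮m)
...   | refl rewrite ≮⇒<ᵇ≡false (n≮n h) | ≡ᵇ-refl h | m≥n⇒m⊓n≡n (n≤1+n h) = refl

module _ (m : ℕ) (S : Slicing) (valid-S : valid m S ≡ true) where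
  open ValidSlicing m S valid-S

  label-hor : ∀ a → W ∸ h ≤ a → a < W → label m (hor S a) ≡ (W ∸ a , suc k)
  label-hor a W∸h≤a a<W = trans (ValidSlicing.label-≡ m (hor S a) valid-hor-S) (cong₂ _,_ maxNewRow≡ rightColumn≡)
    where
    W∸a≤h : W ∸ a ≤ h
    W∸a≤h = W∸h≤a⇒W∸a≤h W∸h≤a
    valid-hor-S : valid m (hor S a) ≡ true
    valid-hor-S = trans (valid-hor a a<W) (≤⇒≤ᵇ≡true W∸a≤h)
    R : Row
    R = range a (width (shape S) ∸ a)
    ends : rightEnd R ≡ W × leftEnd R ≡ a
    ends rewrite width≡W = range-∸-ends a W a<W
    maxNewRow≡ : maxNewRow m (hor S a) ≡ W ∸ a
    maxNewRow≡ rewrite proj₁ ends | proj₂ ends = m≤n⇒m⊓n≡m (≤-trans W∸a≤h (m⊓n≤n _ m))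
    rightColumn≡ : rightColumn (hor S a) ≡ suc k
    rightColumn≡ rewrite ≡ᵇ-refl (rightEnd R) | proj₁ ends = refl

  label-ver : ∀ j → suc j ≤ k → label m (ver S (suc j)) ≡ (suc h ⊓ m , suc j)
  label-ver j j<k = trans (ValidSlicing.label-≡ m (ver S (suc j)) valid-ver-S) (cong₂ _,_ maxNewRow≡ rightColumn≡)
    where
    j<len : suc j ≤ length (shape S)
    j<len = ≤-trans j<k (leadingRowsEndingAt≤length W (shape S))
    valid-ver-S : valid m (ver S (suc j)) ≡ true
    valid-ver-S = trans (valid-ver j j<len) (≤⇒≤ᵇ≡true j<k)
    ends : rightEnd (topRow (addCol W (suc j) (shape S))) ≡ suc W × leftEnd (topRow (addCol W (suc j) (shape S))) ≡ topLeft S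
    ends = topRow-addCol W j (shape S) isPP-S
    maxNewRow≡ : maxNewRow m (ver S (suc j)) ≡ suc h ⊓ m
    maxNewRow≡ rewrite width≡W | proj₁ ends | proj₂ ends =
      trans (cong (_⊓ m) (+-∸-assoc 1 (<⇒≤ left<W))) (sym (suc-⊓-absorb (W ∸ topLeft S) m))
    rightColumn≡ : rightColumn (ver S (suc j)) ≡ suc j
    rightColumn≡ rewrite width≡W | proj₁ ends = leadingRowsEndingAt-addCol W (suc j) (shape S) isPP-S ≤-refl j<len

  horLabels : map (label m) (map (hor S) (range (W ∸ h) h)) ↭ map (_, suc k) (range 1 h)
  horLabels = begin
    map (label m) (map (hor S) as)                 ≡⟨ map-∘ as ⟨
    map (label m ∘ hor S) as                       ≡⟨ map-cong-local (All-range (W ∸ h) h labels) ⟩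
    map ((_, suc k) ∘ (W ∸_)) as                   ≡⟨ map-∘ as ⟩
    map (_, suc k) (map (W ∸_) as)                 ≡⟨ cong (map (_, suc k)) (map-∸-range W (W ∸ h) h (m∸n+n≡m h≤W)) ⟩
    map (_, suc k) (reverse (range 1 h))           ≡⟨ reverse-map (_, suc k) (range 1 h) ⟩
    reverse (map (_, suc k) (range 1 h))           ↭⟨ ↭-reverse (map (_, suc k) (range 1 h)) ⟩
    map (_, suc k) (range 1 h)                     ∎
    where
    open PermutationReasoning
    as : List ℕ
    as = range (W ∸ h) h
    labels : ∀ a → W ∸ h ≤ a → a < W ∸ h + h → label m (hor S a) ≡ (W ∸ a , suc k)
    labels a W∸h≤a a<W = label-hor a W∸h≤a (subst (a <_) (m∸n+n≡m h≤W) a<W)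

  verLabels : map (label m) (map (ver S) (range 1 k)) ≡ map (suc h ⊓ m ,_) (range 1 k)
  verLabels = trans (sym (map-∘ (range 1 k))) (map-cong-local (All-range 1 k labels))
    where
    labels : ∀ j → 1 ≤ j → j < 1 + k → label m (ver S j) ≡ (suc h ⊓ m , j)
    labels (suc j) _ j<k = label-ver j (≤-pred j<k)

  children-labels : map (label m) (children m S) ↭ rule m (label m S)
  children-labels = begin
    map (label m) (children m S)                     ≡⟨ cong (map (label m)) children-≡ ⟩
    map (label m) (hors ++ vers)                     ≡⟨ map-++ (label m) hors vers ⟩
    map (label m) hors ++ map (label m) vers         ↭⟨ ++⁺ horLabels (↭-reflexive verLabels) ⟩
    map (_, suc k) (range 1 h) ++ map (suc h ⊓ m ,_) (range 1 k) ≡⟨ rule-≡ m h k (m⊓n≤n _ m) ⟨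
    rule m (h , k)                                   ≡⟨ cong (rule m) label-≡ ⟨
    rule m (label m S)                               ∎
    where
    open PermutationReasoning
    hors vers : List Slicing
    hors = map (hor S) (range (W ∸ h) h)
    vers = map (ver S) (range 1 k)

theorem11 : (m : ℕ) → 1 ≤ m →
    (label m cell ≡ (1 , 1))
    × ((S : Slicing) → T (valid m S) →
        map (label m) (children m S) ↭ rule m (label m S))
theorem11 (suc m) _ = refl , λ S valid-S → children-labels (suc m) S (T⇒≡true valid-S)
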